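{- Let $K$ be a field of characteristic $0$, let $A(X),B(X)\in K[X]$ with $r:=\max(\deg A,\deg B)>0$ and $A(j)B(j)\neq0$ for every integer $j\ge0$, and let $(c_k)_{k\ge0}$ be a sequence with $c_k\in K\setminus\{0\}$ and $c_{k+1}=c_k\,A(k)/B(k+1)$ for all $k\ge0$. Fix $\gamma_1,\dots,\gamma_{r-1}\in K$ and, for $0\le s\le r-1$, put $$F_s(z)=\sum_{k=0}^\infty (k+\gamma_1)\cdots(k+\gamma_s)\,c_k\,z^{k+1}$$ (the empty product being $1$ for $s=0$). Let $m\ge1$, let $\alpha_1,\dots,\alpha_m\in K\setminus\{0\}$ be pairwise distinct, let $n\ge1$ and $\ell\ge0$ be integers. Define $$P_\ell(z)=\frac{1}{(n-1)!^r}\Big[\mathcal{T}_{\mathbf c}\circ B(\theta_t+1)\circ B(\theta_t+2)\circ\cdots\circ B(\theta_t+n-1)\Big(t^\ell\prod_{i=1}^m(t-\alpha_i)^{rn}\Big)\Big]_{t=z}\in K[z],$$ and for $1\le i\le m$, $0\le s\le r-1$, $$P_{\ell,i,s}(z)=\psi_{i,s}\Big(\frac{P_\ell(z)-P_\ell(t)}{z-t}\Big)\in K[z],$$ where $\psi_{i,s}$ is applied in the variable $t$ ($K[z]$-linearly). Then $\deg P_\ell\le rmn+\ell$ and, for all $1\le i\le m$ and $0\le s\le r-1$, $$\mathrm{ord}_\infty\big(P_\ell(z)F_s(\alpha_i/z)-P_{\ell,i,s}(z)\big)\ge n+1 .$$ That is, $(P_\ell,P_{\ell,i,s})_{1\le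 i\le m,\,0\le s\le r-1}$ is a family of Padé type approximants of weight $(n,\dots,n)\in\mathbb N^{rm}$ and degree $rmn+\ell$ of $(F_s(\alpha_i/z))_{1\le i\le m,\,0\le s\le r-1}$.
   Context: $\theta_t=t\frac{d}{dt}$; for $H\in K[X]$ and $a\in K$, $H(\theta_t+a)$ is the $K$-linear operator on $K[t]$ with $t^p\mapsto H(p+a)t^p$. $\mathcal{T}_{\mathbf c}$ is the $K$-linear map $K[t]\to K[t]$, $t^k\mapsto t^k/c_k$. $\psi_{i,s}:K[t]\to K$ is the $K$-linear map $t^k\mapsto (k+\gamma_1)\cdots(k+\gamma_s)c_k\alpha_i^{k+1}$. For $B(\theta_t+j)$ with $n=1$ the composition is empty (identity). $\mathrm{ord}_\infty$ on $K((1/z))$ sends $\sum_k c_k z^{ -k}$ to $\min\{k: c_k\ne0\}$. A family $(P_0,P_1,\dots,P_N)$ of polynomials is called weight $(n_1,\dots,n_N)$, degree $M$ Padé type approximants of $(f_1,\dots,f_N)\in((1/z)K[[1/z]])^N$ if $\deg P_0\le M$ and $\mathrm{ord}_\infty(P_0f_j-P_j)\ge n_j+1$ for all $j$. -}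

module Defs where

open import Level using (Level; _⊔_) renaming (suc to lsuc)
open import Algebra.Bundles using (CommutativeRing)
open import Relation.Nullary using (¬_)
open import Data.Nat as ℕ using (ℕ; zero; suc)
open import Data.Nat.Base using (_!)
open import Data.Integer as ℤ using (ℤ; +_; -[1+_])
open import Data.Fin using (Fin)
import Data.Fin as Fin
open import Data.List using (List; []; _∷_; _++_; replicate; map; drop; length; upTo)

-- A field: a commutative ring with 0 ≠ 1 and a (total) inverse map which is a
-- two-sided inverse on every nonzero element (the value of 0⁻¹ is irrelevant).
record Field (c ℓ : Level) : Set (lsuc (c ⊔ ℓ)) where
  field
    commutativeRing : CommutativeRing c ℓ
  open CommutativeRing commutativeRing public
  field
    _⁻¹ : Carrier → Carrier
    ⁻¹-inverse : ∀ x → ¬ x ≈ 0# → x * (x ⁻¹) ≈ 1#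
    0≉1 : ¬ 0# ≈ 1#

module Ops {c ℓ : Level} (F : Field c ℓ) where
  open Field F public hiding (zero)

  ι : ℕ → Carrier
  ι zero = 0#
  ι (suc n) = 1# + ι n

  CharZero : Set ℓ
  CharZero = ∀ n → ¬ ι (suc n) ≈ 0#

  _^K_ : Carrier → ℕ → Carrier
  x ^K zero = 1#
  x ^K suc n = x * (x ^K n)

  -- Polynomials in K[X]: coefficient lists, lowest degree first.
  Poly : Set c
  Poly = List Carrier

  coeff : Poly → ℕ → Carrier
  coeff [] k = 0#
  coeff (a ∷ p) zero = a
  coeff (a ∷ p) (suc k) = coeff p k

  eval : Poly → Carrier → Carrier
  eval [] x = 0#
  eval (a ∷ p) x = a + x * eval p x

  DegLe : Poly → ℕ → Set ℓ
  DegLe p d = ∀ k → d ℕ.< k → coeff p k ≈ 0#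

  _+P_ : Poly → Poly → Poly
  [] +P q = q
  (a ∷ p) +P [] = a ∷ p
  (a ∷ p) +P (b ∷ q) = (a + b) ∷ (p +P q)

  scale : Carrier → Poly → Poly
  scale a p = map (a *_) p

  _*P_ : Poly → Poly → Poly
  [] *P q = []
  (a ∷ p) *P q = scale a q +P (0# ∷ (p *P q))

  oneP : Poly
  oneP = 1# ∷ []

  _^P_ : Poly → ℕ → Poly
  p ^P zero = oneP
  p ^P suc n = p *P (p ^P n)

  monoP : ℕ → Poly
  monoP l = replicate l 0# ++ (1# ∷ [])

  linP : Carrier → Poly
  linP a = (- a) ∷ 1# ∷ []

  prodFin : (m : ℕ) → (Fin m → Poly) → Poly
  prodFin zero f = oneP
  prodFin (suc m) f = f Fin.zero *P prodFin m (λ i → f (Fin.suc i))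

  diagFrom : ℕ → (ℕ → Carrier) → Poly → Poly
  diagFrom k w [] = []
  diagFrom k w (a ∷ p) = (w k * a) ∷ diagFrom (suc k) w p

  diag : (ℕ → Carrier) → Poly → Poly
  diag = diagFrom zero

  -- H(θ_t + a) : t^p ↦ H(p + a) t^p
  HOp : Poly → Carrier → Poly → Poly
  HOp H a = diag (λ p → eval H (ι p + a))

  -- T_c : t^k ↦ t^k / c_k
  Tc : (ℕ → Carrier) → Poly → Poly
  Tc cs = diag (λ k → (cs k) ⁻¹)

  -- B(θ+j) ∘ B(θ+j+1) ∘ ⋯ ∘ B(θ+j+k-1)   (k factors; identity for k = 0)
  chainFrom : Poly → ℕ → ℕ → Poly → Poly
  chainFrom B j zero p = p
  chainFrom B j (suc k) p = HOp B (ι j) (chainFrom B (suc j) k p)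

  Pl : (A B : Poly) (r : ℕ) (cs : ℕ → Carrier) (m : ℕ) (α : Fin m → Carrier)
       (n l : ℕ) → Poly
  Pl A B r cs m α n l =
    scale (ι (((n ℕ.∸ 1) !) ℕ.^ r) ⁻¹)
      (Tc cs (chainFrom B 1 (n ℕ.∸ 1)
        (monoP l *P prodFin m (λ i → linP (α i) ^P (r ℕ.* n)))))

  -- (k+γ_1)⋯(k+γ_s)  (γ is indexed from 1; empty product = 1)
  wgt : (γ : ℕ → Carrier) → ℕ → ℕ → Carrier
  wgt γ zero k = 1#
  wgt γ (suc s) k = wgt γ s k * (ι k + γ (suc s))

  -- ψ_{i,s} : t^k ↦ (k+γ_1)⋯(k+γ_s) c_k α_i^{k+1}
  psiFrom : ℕ → (γ : ℕ → Carrier) (cs : ℕ → Carrier) (a : Carrier) (s : ℕ) → Poly → Carrier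
  psiFrom k γ cs a s [] = 0#
  psiFrom k γ cs a s (x ∷ p) =
    x * (wgt γ s k * (cs k * (a ^K suc k))) + psiFrom (suc k) γ cs a s p

  psi : (γ : ℕ → Carrier) (cs : ℕ → Carrier) (a : Carrier) (s : ℕ) → Poly → Carrier
  psi = psiFrom zero

  -- (P(z) - P(t))/(z - t) ∈ K[t][z], as a list (in z) of polynomials in t.
  -- Since (z^j - t^j)/(z - t) = Σ_{a+b=j-1} z^a t^b, the coefficient of z^a
  -- is Σ_b p_{a+b+1} t^b, i.e. the coefficient list  drop (a+1) p.
  divDiff : Poly → List Poly
  divDiff p = map (λ a → drop (suc a) p) (upTo (length p))

  Plis : (γ : ℕ → Carrier) (cs : ℕ → Carrier) (a : Carrier) (s : ℕ) → Poly → Poly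
  Plis γ cs a s P = map (psi γ cs a s) (divDiff P)

  -- Formal power series in z: coefficient functions ℕ → K (coefficient of z^k).
  -- F_s(z) = Σ_k (k+γ_1)⋯(k+γ_s) c_k z^{k+1}
  Fs : (γ : ℕ → Carrier) (cs : ℕ → Carrier) (s : ℕ) → ℕ → Carrier
  Fs γ cs s zero = 0#
  Fs γ cs s (suc k) = wgt γ s k * cs k

  -- Laurent series in 1/z: f k is the coefficient of z^{-k}, k ∈ ℤ.
  Laurent : Set c
  Laurent = ℤ → Carrier

  substInv : Carrier → (ℕ → Carrier) → Laurent
  substInv a g (+ k) = (a ^K k) * g k
  substInv a g -[1+ k ] = 0#

  polyL : Poly → Laurent
  polyL p (+ zero) = coeff p zero
  polyL p (+ suc k) = 0#
  polyL p -[1+ k ] = coeff p (suc k)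

  -- product of a polynomial with a Laurent series:
  -- coefficient of z^{-k} of (Σ_j p_j z^j)·f is Σ_j p_j f_{k+j}
  polyTimesFrom : ℕ → Poly → Laurent → Laurent
  polyTimesFrom j [] f k = 0#
  polyTimesFrom j (a ∷ p) f k = a * f (k ℤ.+ + j) + polyTimesFrom (suc j) p f k

  polyTimes : Poly → Laurent → Laurent
  polyTimes = polyTimesFrom zero

  _-L_ : Laurent → Laurent → Laurent
  (f -L g) k = f k - g k

  OrdGe : Laurent → ℤ → Set ℓ
  OrdGe f N = ∀ k → k ℤ.< N → f k ≈ 0#

module Submission where

open import Defs
open import Level using (Level; _⊔_)
open import Function using (_∘_)
open import Relation.Nullary using (¬_)
open import Relation.Binary.PropositionalEquality as ≡ using (_≡_)
open import Data.Nat as ℕ using (ℕ; zero; suc; z≤n; s≤s)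
open import Data.Nat.Base using (_!)
import Data.Nat.Properties as ℕP
open import Data.Nat.Tactic.RingSolver using (solve-∀)
open import Data.Integer as ℤ using (+_; -[1+_])
import Data.Integer.Properties as ℤP
open import Data.Fin as Fin using (Fin)
open import Data.List using ([]; _∷_; map; drop; length; applyUpTo; upTo)
import Data.List.Properties as ListP
open import Data.Product using (_×_; _,_)
open import Data.Sum using (_⊎_)

-- Write Λ α R for the functional t^j ↦ R(j) α^j.  The coefficient of
-- z^(-k) in P(z) F_s(α/z) is α^k Λ α (j ↦ (j+k-1+γ_1)⋯(j+k-1+γ_s) c_(j+k-1)) P for
-- k ≥ 1, and for k ≤ 0 it is exactly the coefficient of z^(-k) in P_(ℓ,i,s), so only
-- the coefficients with 1 ≤ k ≤ n have to vanish.  Moving Λ through T_c and the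
-- operators B(θ+j) replaces P by t^ℓ ∏(t-α_i)^(rn) and multiplies the weight by
-- c_x^(-1) B(x+1)⋯B(x+n-1); the recursion for c turns the weight into the polynomial
-- B(x+k)⋯B(x+n-1)(x+k-1+γ_1)⋯(x+k-1+γ_s)A(x)⋯A(x+k-2) in x, of degree < rn.  Finally
-- Λ α R q = 0 whenever (t-α)^N divides q and R is a polynomial of degree < N, since
-- Λ α R ((t-α) q) = α Λ α (ΔR) q.

suc[er+s+tr]≡suc[s]+[t+e]r : ∀ e r s t → suc ((e ℕ.* r ℕ.+ s) ℕ.+ t ℕ.* r) ≡ suc s ℕ.+ (t ℕ.+ e) ℕ.* r
suc[er+s+tr]≡suc[s]+[t+e]r = solve-∀

l+m[rn]≡rmn+l : ∀ r m n l → l ℕ.+ m ℕ.* (r ℕ.* n) ≡ r ℕ.* m ℕ.* n ℕ.+ l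
l+m[rn]≡rmn+l = solve-∀

suc[er+s+tr]≤r[1+n] : ∀ {r s t e n} → s ℕ.< r → t ℕ.+ e ≡ n →
                      suc ((e ℕ.* r ℕ.+ s) ℕ.+ t ℕ.* r) ℕ.≤ r ℕ.* suc n
suc[er+s+tr]≤r[1+n] {r} {s} {t} {e} {n} s<r t+e≡n = begin
  suc ((e ℕ.* r ℕ.+ s) ℕ.+ t ℕ.* r)  ≡⟨ suc[er+s+tr]≡suc[s]+[t+e]r e r s t ⟩
  suc s ℕ.+ (t ℕ.+ e) ℕ.* r           ≡⟨ ≡.cong (λ k → suc s ℕ.+ k ℕ.* r) t+e≡n ⟩
  suc s ℕ.+ n ℕ.* r                   ≤⟨ ℕP.+-monoˡ-≤ (n ℕ.* r) s<r ⟩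
  r ℕ.+ n ℕ.* r                       ≡⟨ ℕP.*-comm (suc n) r ⟩
  r ℕ.* suc n                         ∎
  where open ℕP.≤-Reasoning

-d+e≡-[d∸e] : ∀ {d e} → e ℕ.≤ d → ℤ.- (+ d) ℤ.+ + e ≡ ℤ.- (+ (d ℕ.∸ e))
-d+e≡-[d∸e] {d} {e} e≤d = ≡.trans (ℤP.-m+n≡n⊖m d e) (ℤP.⊖-≤ e≤d)

-d+[1+d+x]≡1+x : ∀ d x → ℤ.- (+ d) ℤ.+ + (suc d ℕ.+ x) ≡ + suc x
-d+[1+d+x]≡1+x d x =
  ≡.trans (ℤP.-m+n≡n⊖m d (suc d ℕ.+ x))
    (≡.trans (ℤP.⊖-≥ (ℕP.≤-trans (ℕP.n≤1+n d) (ℕP.m≤m+n (suc d) x)))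
      (≡.cong +_ (≡.trans (≡.cong (ℕ._∸ d) (≡.sym (ℕP.+-suc d x))) (ℕP.m+n∸m≡n d (suc x)))))

module _ {c ℓ : Level} (K : Field c ℓ) where
  open Ops K
  open import Algebra.Properties.Ring ring using (x[y-z]≈xy-xz; -‿distribˡ-*; -‿distribʳ-*)
  open import Algebra.Properties.AbelianGroup +-abelianGroup
    using (//-rightDividesˡ; //-rightDividesʳ; x∙y⁻¹≈ε⇒x≈y; x≈y⇒x∙y⁻¹≈ε)
  open import Algebra.Solver.Ring.NaturalCoefficients.Default commutativeSemiring
    using (solve; _:=_; _:+_; _:*_)
  open import Relation.Binary.Reasoning.Setoid setoid

  x≈z+y⇒x-y≈z : ∀ {x y z} → x ≈ z + y → x - y ≈ z
  x≈z+y⇒x-y≈z {y = y} {z} e = trans (+-congʳ e) (//-rightDividesʳ y z)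

  x≈[x-y]+y : ∀ x y → x ≈ (x - y) + y
  x≈[x-y]+y x y = sym (//-rightDividesˡ y x)

  x*0+y*0≈0 : ∀ x y → x * 0# + y * 0# ≈ 0#
  x*0+y*0≈0 x y = trans (+-cong (zeroʳ x) (zeroʳ y)) (+-identityʳ 0#)

  -x*y+x*z≈x*[z-y] : ∀ x y z → - x * y + x * z ≈ x * (z - y)
  -x*y+x*z≈x*[z-y] x y z = begin
    - x * y + x * z     ≈⟨ +-comm _ _ ⟩
    x * z + - x * y     ≈⟨ +-congˡ (trans (sym (-‿distribʳ-* x y)) (-‿distribˡ-* x y)) ⟨
    x * z + x * - y     ≈⟨ distribˡ x z (- y) ⟨
    x * (z - y)         ∎

  x*y≉0⇒y≉0 : ∀ {x y} → ¬ x * y ≈ 0# → ¬ y ≈ 0#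
  x*y≉0⇒y≉0 {x} xy≉0 y≈0 = xy≉0 (trans (*-congˡ y≈0) (zeroʳ x))

  Λ : Carrier → (ℕ → Carrier) → Poly → Carrier
  Λ α R [] = 0#
  Λ α R (x ∷ q) = x * R 0 + α * Λ α (R ∘ suc) q

  Λ-cong : ∀ α {R S} q → (∀ j → R j ≈ S j) → Λ α R q ≈ Λ α S q
  Λ-cong α [] e = refl
  Λ-cong α (x ∷ q) e = +-cong (*-congˡ (e 0)) (*-congˡ (Λ-cong α q (e ∘ suc)))

  Λ-zero : ∀ α {R} q → (∀ j → R j ≈ 0#) → Λ α R q ≈ 0#
  Λ-zero α [] e = refl
  Λ-zero α (x ∷ q) e =
    trans (+-cong (*-congˡ (e 0)) (*-congˡ (Λ-zero α q (e ∘ suc)))) (x*0+y*0≈0 x α)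

  Λ-linear : ∀ α u v R S q →
             Λ α (λ j → u * R j + v * S j) q ≈ u * Λ α R q + v * Λ α S q
  Λ-linear α u v R S [] = sym (x*0+y*0≈0 u v)
  Λ-linear α u v R S (x ∷ q) = begin
    x * (u * R 0 + v * S 0) + α * Λ α (λ j → u * R (suc j) + v * S (suc j)) q
      ≈⟨ +-congˡ (*-congˡ (Λ-linear α u v (R ∘ suc) (S ∘ suc) q)) ⟩
    x * (u * R 0 + v * S 0) + α * (u * Λ α (R ∘ suc) q + v * Λ α (S ∘ suc) q)
      ≈⟨ regroup x u v (R 0) (S 0) α (Λ α (R ∘ suc) q) (Λ α (S ∘ suc) q) ⟩
    u * (x * R 0 + α * Λ α (R ∘ suc) q) + v * (x * S 0 + α * Λ α (S ∘ suc) q) ∎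
    where
    regroup : ∀ x u v r s α l m →
      x * (u * r + v * s) + α * (u * l + v * m) ≈ u * (x * r + α * l) + v * (x * s + α * m)
    regroup = solve 8 (λ x u v r s α l m →
      x :* (u :* r :+ v :* s) :+ α :* (u :* l :+ v :* m)
        := u :* (x :* r :+ α :* l) :+ v :* (x :* s :+ α :* m)) refl

  Λ-sub : ∀ α R S q → Λ α (λ j → R j - S j) q ≈ Λ α R q - Λ α S q
  Λ-sub α R S [] = sym (-‿inverseʳ 0#)
  Λ-sub α R S (x ∷ q) = begin
    x * (R 0 - S 0) + α * Λ α (λ j → R (suc j) - S (suc j)) q
      ≈⟨ +-congˡ (*-congˡ (Λ-sub α (R ∘ suc) (S ∘ suc) q)) ⟩
    x * (r - s) + α * (l - m)
      ≈⟨ x≈z+y⇒x-y≈z (begin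
           x * r + α * l
             ≈⟨ +-cong (*-congˡ (x≈[x-y]+y r s)) (*-congˡ (x≈[x-y]+y l m)) ⟩
           x * ((r - s) + s) + α * ((l - m) + m)
             ≈⟨ regroup x (r - s) s α (l - m) m ⟩
           (x * (r - s) + α * (l - m)) + (x * s + α * m) ∎) ⟨
    (x * r + α * l) - (x * s + α * m) ∎
    where
    r = R 0
    s = S 0
    l = Λ α (R ∘ suc) q
    m = Λ α (S ∘ suc) q
    regroup : ∀ x d s α e m → x * (d + s) + α * (e + m) ≈ (x * d + α * e) + (x * s + α * m)
    regroup = solve 6 (λ x d s α e m →
      x :* (d :+ s) :+ α :* (e :+ m) := (x :* d :+ α :* e) :+ (x :* s :+ α :* m)) refl

  Λ-scale : ∀ α R a q → Λ α R (scale a q) ≈ a * Λ α R q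
  Λ-scale α R a [] = sym (zeroʳ a)
  Λ-scale α R a (x ∷ q) =
    trans (+-congˡ (*-congˡ (Λ-scale α (R ∘ suc) a q))) (regroup a x (R 0) α (Λ α (R ∘ suc) q))
    where
    regroup : ∀ a x r α l → (a * x) * r + α * (a * l) ≈ a * (x * r + α * l)
    regroup = solve 5 (λ a x r α l → (a :* x) :* r :+ α :* (a :* l) := a :* (x :* r :+ α :* l)) refl

  Λ-+P : ∀ α R p q → Λ α R (p +P q) ≈ Λ α R p + Λ α R q
  Λ-+P α R [] q = sym (+-identityˡ _)
  Λ-+P α R (a ∷ p) [] = sym (+-identityʳ _)
  Λ-+P α R (a ∷ p) (b ∷ q) =
    trans (+-congˡ (*-congˡ (Λ-+P α (R ∘ suc) p q)))
          (regroup a b (R 0) α (Λ α (R ∘ suc) p) (Λ α (R ∘ suc) q))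
    where
    regroup : ∀ a b r α u v → (a + b) * r + α * (u + v) ≈ (a * r + α * u) + (b * r + α * v)
    regroup = solve 6 (λ a b r α u v →
      (a :+ b) :* r :+ α :* (u :+ v) := (a :* r :+ α :* u) :+ (b :* r :+ α :* v)) refl

  Λ-∷-*P : ∀ α R x a b → Λ α R ((x ∷ a) *P b) ≈ x * Λ α R b + α * Λ α (R ∘ suc) (a *P b)
  Λ-∷-*P α R x a b = begin
    Λ α R (scale x b +P (0# ∷ (a *P b)))
      ≈⟨ Λ-+P α R (scale x b) (0# ∷ (a *P b)) ⟩
    Λ α R (scale x b) + (0# * R 0 + α * Λ α (R ∘ suc) (a *P b))
      ≈⟨ +-cong (Λ-scale α R x b) (trans (+-congʳ (zeroˡ (R 0))) (+-identityˡ _)) ⟩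
    x * Λ α R b + α * Λ α (R ∘ suc) (a *P b) ∎

  Λ-*P : ∀ α R a b → Λ α R (a *P b) ≈ Λ α (λ i → Λ α (λ j → R (i ℕ.+ j)) a) b
  Λ-*P α R [] b = sym (Λ-zero α b (λ _ → refl))
  Λ-*P α R (x ∷ a) b = begin
    Λ α R ((x ∷ a) *P b)
      ≈⟨ Λ-∷-*P α R x a b ⟩
    x * Λ α R b + α * Λ α (R ∘ suc) (a *P b)
      ≈⟨ +-congˡ (*-congˡ (Λ-*P α (R ∘ suc) a b)) ⟩
    x * Λ α R b + α * Λ α (λ i → Λ α (λ j → R (suc (i ℕ.+ j))) a) b
      ≈⟨ Λ-linear α x α R _ b ⟨
    Λ α (λ i → x * R i + α * Λ α (λ j → R (suc (i ℕ.+ j))) a) b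
      ≈⟨ Λ-cong α b reindex ⟩
    Λ α (λ i → Λ α (λ j → R (i ℕ.+ j)) (x ∷ a)) b ∎
    where
    reindex : ∀ i → x * R i + α * Λ α (λ j → R (suc (i ℕ.+ j))) a
                  ≈ x * R (i ℕ.+ 0) + α * Λ α (λ j → R (i ℕ.+ suc j)) a
    reindex i = +-cong (*-congˡ (reflexive (≡.cong R (≡.sym (ℕP.+-identityʳ i)))))
                       (*-congˡ (Λ-cong α a (λ j → reflexive (≡.cong R (≡.sym (ℕP.+-suc i j))))))

  -- Finite differences

  Δ : (ℕ → Carrier) → ℕ → Carrier
  Δ R x = R (suc x) - R x

  DegLt : ℕ → (ℕ → Carrier) → Set ℓ
  DegLt zero R = ∀ x → R x ≈ 0#
  DegLt (suc d) R = DegLt d (Δ R)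

  DegLt-shift : ∀ d R → DegLt d R → DegLt d (R ∘ suc)
  DegLt-shift zero R h = h ∘ suc
  DegLt-shift (suc d) R h = DegLt-shift d (Δ R) h

  DegLt-shiftBy : ∀ d i R → DegLt d R → DegLt d (λ j → R (i ℕ.+ j))
  DegLt-shiftBy d zero R h = h
  DegLt-shiftBy d (suc i) R h = DegLt-shiftBy d i (R ∘ suc) (DegLt-shift d R h)

  DegLt-cong : ∀ d {R S} → (∀ x → R x ≈ S x) → DegLt d R → DegLt d S
  DegLt-cong zero e h x = trans (sym (e x)) (h x)
  DegLt-cong (suc d) e h = DegLt-cong d (λ x → +-cong (e (suc x)) (-‿cong (e x))) h

  Δ-+ : ∀ R S x → Δ R x + Δ S x ≈ Δ (λ y → R y + S y) x
  Δ-+ R S x = sym (x≈z+y⇒x-y≈z (begin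
    a′ + b′                               ≈⟨ +-cong (x≈[x-y]+y a′ a) (x≈[x-y]+y b′ b) ⟩
    ((a′ - a) + a) + ((b′ - b) + b)       ≈⟨ regroup (a′ - a) a (b′ - b) b ⟩
    ((a′ - a) + (b′ - b)) + (a + b)       ∎))
    where
    a′ = R (suc x)
    a = R x
    b′ = S (suc x)
    b = S x
    regroup : ∀ d a e b → (d + a) + (e + b) ≈ (d + e) + (a + b)
    regroup = solve 4 (λ d a e b → (d :+ a) :+ (e :+ b) := (d :+ e) :+ (a :+ b)) refl

  DegLt-+ : ∀ d R S → DegLt d R → DegLt d S → DegLt d (λ x → R x + S x)
  DegLt-+ zero R S hR hS x = trans (+-cong (hR x) (hS x)) (+-identityʳ 0#)
  DegLt-+ (suc d) R S hR hS = DegLt-cong d (Δ-+ R S) (DegLt-+ d (Δ R) (Δ S) hR hS)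

  DegLt-scale : ∀ d k R → DegLt d R → DegLt d (λ x → k * R x)
  DegLt-scale zero k R h x = trans (*-congˡ (h x)) (zeroʳ k)
  DegLt-scale (suc d) k R h =
    DegLt-cong d (λ x → x[y-z]≈xy-xz k (R (suc x)) (R x)) (DegLt-scale d k (Δ R) h)

  DegLt-suc : ∀ d R → DegLt d R → DegLt (suc d) R
  DegLt-suc zero R h x = x≈y⇒x∙y⁻¹≈ε (trans (h (suc x)) (sym (h x)))
  DegLt-suc (suc d) R h = DegLt-suc d (Δ R) h

  DegLt-mono : ∀ d e R → d ℕ.≤ e → DegLt d R → DegLt e R
  DegLt-mono zero zero R z≤n h = h
  DegLt-mono zero (suc e) R z≤n h = DegLt-suc e R (DegLt-mono zero e R z≤n h)
  DegLt-mono (suc d) (suc e) R (s≤s d≤e) h = DegLt-mono d e (Δ R) d≤e h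

  DegLt-const : ∀ k → DegLt 1 (λ _ → k)
  DegLt-const k x = -‿inverseʳ k

  DegLt-1⇒const : ∀ R → DegLt 1 R → ∀ x → R x ≈ R 0
  DegLt-1⇒const R h zero = refl
  DegLt-1⇒const R h (suc x) = trans (x∙y⁻¹≈ε⇒x≈y _ _ (h x)) (DegLt-1⇒const R h x)

  Δ-* : ∀ R S x → Δ R x * S (suc x) + R x * Δ S x ≈ Δ (λ y → R y * S y) x
  Δ-* R S x = sym (x≈z+y⇒x-y≈z (begin
    a′ * b′                                        ≈⟨ *-cong (x≈[x-y]+y a′ a) (x≈[x-y]+y b′ b) ⟩
    ((a′ - a) + a) * ((b′ - b) + b)                ≈⟨ expand (a′ - a) a (b′ - b) b ⟩
    ((a′ - a) * ((b′ - b) + b) + a * (b′ - b)) + a * b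
      ≈⟨ +-congʳ (+-congʳ (*-congˡ (x≈[x-y]+y b′ b))) ⟨
    ((a′ - a) * b′ + a * (b′ - b)) + a * b        ∎))
    where
    a′ = R (suc x)
    a = R x
    b′ = S (suc x)
    b = S x
    expand : ∀ d a e b → (d + a) * (e + b) ≈ (d * (e + b) + a * e) + a * b
    expand = solve 4 (λ d a e b → (d :+ a) :* (e :+ b) := (d :* (e :+ b) :+ a :* e) :+ a :* b) refl

  DegLt-* : ∀ a b R S → DegLt (suc a) R → DegLt (suc b) S →
            DegLt (suc (a ℕ.+ b)) (λ x → R x * S x)
  DegLt-* zero b R S hR hS =
    DegLt-cong (suc b) (λ x → *-congʳ (sym (DegLt-1⇒const R hR x))) (DegLt-scale (suc b) (R 0) S hS)
  DegLt-* (suc a) zero R S hR hS =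
    ≡.subst (λ d → DegLt (suc d) (λ x → R x * S x)) (≡.sym (ℕP.+-identityʳ (suc a)))
      (DegLt-cong (suc (suc a)) (λ x → trans (*-comm _ _) (*-congˡ (sym (DegLt-1⇒const S hS x))))
        (DegLt-scale (suc (suc a)) (S 0) R hR))
  DegLt-* (suc a) (suc b) R S hR hS =
    DegLt-cong (suc (a ℕ.+ suc b)) (Δ-* R S)
      (DegLt-+ (suc (a ℕ.+ suc b)) _ _
        (DegLt-* a (suc b) (Δ R) (S ∘ suc) hR (DegLt-shift (suc (suc b)) S hS))
        (≡.subst (λ d → DegLt (suc d) (λ x → R x * Δ S x)) (≡.sym (ℕP.+-suc a b))
          (DegLt-* (suc a) b R (Δ S) hR hS)))

  ι-+ : ∀ a b → ι (a ℕ.+ b) ≈ ι a + ι b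
  ι-+ zero b = sym (+-identityˡ _)
  ι-+ (suc a) b = trans (+-congˡ (ι-+ a b)) (sym (+-assoc 1# (ι a) (ι b)))

  DegLt-ι+ : ∀ k → DegLt 2 (λ x → ι x + k)
  DegLt-ι+ k = DegLt-cong 1 (λ x → sym (x≈z+y⇒x-y≈z (+-assoc 1# (ι x) k))) (DegLt-const 1#)

  eval-cong : ∀ A {y z} → y ≈ z → eval A y ≈ eval A z
  eval-cong [] e = refl
  eval-cong (a ∷ A) e = +-congˡ (*-cong e (eval-cong A e))

  eval-zero : ∀ A → (∀ k → coeff A k ≈ 0#) → ∀ y → eval A y ≈ 0#
  eval-zero [] h y = refl
  eval-zero (a ∷ A) h y =
    trans (+-cong (h 0) (trans (*-congˡ (eval-zero A (h ∘ suc) y)) (zeroʳ y))) (+-identityʳ 0#)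

  DegLt-eval : ∀ A d k → DegLe A d → DegLt (suc d) (λ x → eval A (ι x + k))
  DegLt-eval [] d k h = DegLt-mono 1 (suc d) (λ _ → 0#) (s≤s z≤n) (DegLt-const 0#)
  DegLt-eval (a ∷ A) zero k h =
    DegLt-cong 1 (λ x → sym (trans (+-congˡ (trans (*-congˡ (eval-zero A tail≈0 _)) (zeroʳ _)))
                                   (+-identityʳ a)))
      (DegLt-const a)
    where
    tail≈0 : ∀ j → coeff A j ≈ 0#
    tail≈0 j = h (suc j) (s≤s z≤n)
  DegLt-eval (a ∷ A) (suc d) k h =
    DegLt-+ (suc (suc d)) _ _
      (DegLt-mono 1 (suc (suc d)) (λ _ → a) (s≤s z≤n) (DegLt-const a))
      (DegLt-* 1 d _ _ (DegLt-ι+ k) (DegLt-eval A d k (λ j d<j → h (suc j) (s≤s d<j))))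

  Λ-linP-*P : ∀ α R q → Λ α R (linP α *P q) ≈ α * Λ α (Δ R) q
  Λ-linP-*P α R q = begin
    Λ α R (linP α *P q)
      ≈⟨ Λ-∷-*P α R (- α) (1# ∷ []) q ⟩
    - α * Λ α R q + α * Λ α (R ∘ suc) ((1# ∷ []) *P q)
      ≈⟨ +-congˡ (*-congˡ (trans (Λ-∷-*P α (R ∘ suc) 1# [] q)
                                 (trans (+-cong (*-identityˡ _) (zeroʳ α)) (+-identityʳ _)))) ⟩
    - α * Λ α R q + α * Λ α (R ∘ suc) q
      ≈⟨ -x*y+x*z≈x*[z-y] α _ _ ⟩
    α * (Λ α (R ∘ suc) q - Λ α R q)
      ≈⟨ *-congˡ (Λ-sub α (R ∘ suc) R q) ⟨
    α * Λ α (Δ R) q ∎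

  -- the dual form of (t - α)^N ∣ q
  VanishesToOrder : Carrier → ℕ → Poly → Set (c ⊔ ℓ)
  VanishesToOrder α N q = ∀ R → DegLt N R → Λ α R q ≈ 0#

  vanishes-linP-*P : ∀ α N q → VanishesToOrder α N q → VanishesToOrder α (suc N) (linP α *P q)
  vanishes-linP-*P α N q v R h = trans (Λ-linP-*P α R q) (trans (*-congˡ (v (Δ R) h)) (zeroʳ α))

  vanishes-^P : ∀ α N → VanishesToOrder α N (linP α ^P N)
  vanishes-^P α zero R h = Λ-zero α oneP h
  vanishes-^P α (suc N) = vanishes-linP-*P α N (linP α ^P N) (vanishes-^P α N)

  vanishes-*P-left : ∀ α N a b → VanishesToOrder α N b → VanishesToOrder α N (a *P b)
  vanishes-*P-left α N [] b v R h = refl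
  vanishes-*P-left α N (x ∷ a) b v R h =
    trans (Λ-∷-*P α R x a b)
      (trans (+-cong (*-congˡ (v R h))
                     (*-congˡ (vanishes-*P-left α N a b v (R ∘ suc) (DegLt-shift N R h))))
             (x*0+y*0≈0 x α))

  vanishes-*P-right : ∀ α N a b → VanishesToOrder α N a → VanishesToOrder α N (a *P b)
  vanishes-*P-right α N a b v R h =
    trans (Λ-*P α R a b) (Λ-zero α b (λ i → v _ (DegLt-shiftBy N i R h)))

  vanishes-prodFin : ∀ α N m (f : Fin m → Poly) i →
                     VanishesToOrder α N (f i) → VanishesToOrder α N (prodFin m f)
  vanishes-prodFin α N (suc m) f Fin.zero v =
    vanishes-*P-right α N (f Fin.zero) _ v
  vanishes-prodFin α N (suc m) f (Fin.suc i) v =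
    vanishes-*P-left α N (f Fin.zero) _ (vanishes-prodFin α N m (f ∘ Fin.suc) i v)

  -- The operators T_c and B(θ+j) under Λ

  prodEval : Poly → ℕ → ℕ → ℕ → Carrier
  prodEval H j zero x = 1#
  prodEval H j (suc t) x = eval H (ι x + ι j) * prodEval H (suc j) t x

  prodEval-shift : ∀ H t j x → prodEval H (suc j) t x ≈ prodEval H j t (suc x)
  prodEval-shift H zero j x = refl
  prodEval-shift H (suc t) j x =
    *-cong (eval-cong H (regroup 1# (ι x) (ι j))) (prodEval-shift H t (suc j) x)
    where
    regroup : ∀ o x j → x + (o + j) ≈ (o + x) + j
    regroup = solve 3 (λ o x j → x :+ (o :+ j) := (o :+ x) :+ j) refl

  prodEval-+ : ∀ H j a b x → prodEval H j (a ℕ.+ b) x ≈ prodEval H j a x * prodEval H (a ℕ.+ j) b x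
  prodEval-+ H j zero b x = sym (*-identityˡ _)
  prodEval-+ H j (suc a) b x =
    trans (*-congˡ (prodEval-+ H (suc j) a b x))
      (trans (sym (*-assoc _ _ _))
             (*-congˡ (reflexive (≡.cong (λ i → prodEval H i b x) (ℕP.+-suc a j)))))

  DegLt-prodEval : ∀ H r → DegLe H r → ∀ t j → DegLt (suc (t ℕ.* r)) (prodEval H j t)
  DegLt-prodEval H r h zero j = DegLt-const 1#
  DegLt-prodEval H r h (suc t) j =
    DegLt-* r (t ℕ.* r) _ _ (DegLt-eval H r (ι j) h) (DegLt-prodEval H r h t (suc j))

  DegLt-wgt : ∀ γ s t → DegLt (suc s) (λ x → wgt γ s (t ℕ.+ x))
  DegLt-wgt γ zero t = DegLt-const 1#
  DegLt-wgt γ (suc s) t =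
    ≡.subst (λ d → DegLt (suc d) (λ x → wgt γ (suc s) (t ℕ.+ x))) (ℕP.+-comm s 1)
      (DegLt-* s 1 _ _ (DegLt-wgt γ s t) (DegLt-cong 2 linear (DegLt-ι+ (ι t + γ (suc s)))))
    where
    linear : ∀ x → ι x + (ι t + γ (suc s)) ≈ ι (t ℕ.+ x) + γ (suc s)
    linear x = sym (trans (+-congʳ (trans (ι-+ t x) (+-comm _ _))) (+-assoc _ _ _))

  Λ-diagFrom : ∀ α k w R q → Λ α R (diagFrom k w q) ≈ Λ α (λ j → w (k ℕ.+ j) * R j) q
  Λ-diagFrom α k w R [] = refl
  Λ-diagFrom α k w R (a ∷ q) = +-cong
    (trans (regroup (w k) a (R 0)) (*-congˡ (*-congʳ (reflexive (≡.cong w (≡.sym (ℕP.+-identityʳ k)))))))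
    (*-congˡ (trans (Λ-diagFrom α (suc k) w (R ∘ suc) q)
                    (Λ-cong α q (λ j → *-congʳ (reflexive (≡.cong w (≡.sym (ℕP.+-suc k j))))))))
    where
    regroup : ∀ w a r → (w * a) * r ≈ a * (w * r)
    regroup = solve 3 (λ w a r → (w :* a) :* r := a :* (w :* r)) refl

  Λ-chainFrom : ∀ α B R j k q → Λ α R (chainFrom B j k q) ≈ Λ α (λ x → prodEval B j k x * R x) q
  Λ-chainFrom α B R j zero q = Λ-cong α q (λ x → sym (*-identityˡ _))
  Λ-chainFrom α B R j (suc k) q =
    trans (Λ-diagFrom α 0 (λ p → eval B (ι p + ι j)) R (chainFrom B (suc j) k q))
      (trans (Λ-chainFrom α B (λ x → eval B (ι x + ι j) * R x) (suc j) k q)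
             (Λ-cong α q (λ x → regroup (prodEval B (suc j) k x) (eval B (ι x + ι j)) (R x))))
    where
    regroup : ∀ p b r → p * (b * r) ≈ (b * p) * r
    regroup = solve 3 (λ p b r → p :* (b :* r) := (b :* p) :* r) refl

  reducedWeight : Poly → Poly → (γ : ℕ → Carrier) (s t e : ℕ) → ℕ → Carrier
  reducedWeight A B γ s t e x = (prodEval B (t ℕ.+ 1) e x * wgt γ s (t ℕ.+ x)) * prodEval A 0 t x

  DegLt-reducedWeight : ∀ A B r → DegLe A r → DegLe B r → ∀ γ s t e →
    DegLt (suc ((e ℕ.* r ℕ.+ s) ℕ.+ t ℕ.* r)) (reducedWeight A B γ s t e)
  DegLt-reducedWeight A B r hA hB γ s t e =
    DegLt-* (e ℕ.* r ℕ.+ s) (t ℕ.* r) _ _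
      (DegLt-* (e ℕ.* r) s _ _ (DegLt-prodEval B r hB e (t ℕ.+ 1)) (DegLt-wgt γ s t))
      (DegLt-prodEval A r hA t 0)

  module _ (A B : Poly) (cs : ℕ → Carrier)
           (B≉0 : ∀ j → ¬ eval B (ι j) ≈ 0#)
           (cs-rec : ∀ k → cs (suc k) ≈ cs k * (eval A (ι k) * (eval B (ι (suc k)) ⁻¹)))
           where

    cs-step : ∀ x → cs (suc x) * eval B (ι (suc x)) ≈ cs x * eval A (ι x)
    cs-step x = begin
      cs (suc x) * b                  ≈⟨ *-congʳ (cs-rec x) ⟩
      (cs x * (eval A (ι x) * b ⁻¹)) * b ≈⟨ regroup (cs x) (eval A (ι x)) (b ⁻¹) b ⟩
      (cs x * eval A (ι x)) * (b * b ⁻¹) ≈⟨ *-congˡ (⁻¹-inverse b (B≉0 (suc x))) ⟩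
      (cs x * eval A (ι x)) * 1#      ≈⟨ *-identityʳ _ ⟩
      cs x * eval A (ι x)             ∎
      where
      b = eval B (ι (suc x))
      regroup : ∀ c a bi b → (c * (a * bi)) * b ≈ (c * a) * (b * bi)
      regroup = solve 4 (λ c a bi b → (c :* (a :* bi)) :* b := (c :* a) :* (b :* bi)) refl

    cs-telescope : ∀ t x → cs (t ℕ.+ x) * prodEval B 1 t x ≈ cs x * prodEval A 0 t x
    cs-telescope zero x = refl
    cs-telescope (suc t) x = begin
      cs (suc t ℕ.+ x) * (eval B (ι x + ι 1) * prodEval B 2 t x)
        ≈⟨ *-cong (reflexive (≡.cong cs (≡.sym (ℕP.+-suc t x))))
                  (*-cong (eval-cong B x+1≈1+x) (prodEval-shift B t 1 x)) ⟩
      cs (t ℕ.+ suc x) * (eval B (ι (suc x)) * prodEval B 1 t (suc x))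
        ≈⟨ regroup _ _ _ ⟩
      (cs (t ℕ.+ suc x) * prodEval B 1 t (suc x)) * eval B (ι (suc x))
        ≈⟨ *-congʳ (cs-telescope t (suc x)) ⟩
      (cs (suc x) * prodEval A 0 t (suc x)) * eval B (ι (suc x))
        ≈⟨ regroup′ _ _ _ ⟩
      (cs (suc x) * eval B (ι (suc x))) * prodEval A 0 t (suc x)
        ≈⟨ *-cong (cs-step x) (sym (prodEval-shift A t 0 x)) ⟩
      (cs x * eval A (ι x)) * prodEval A 1 t x
        ≈⟨ *-assoc _ _ _ ⟩
      cs x * (eval A (ι x) * prodEval A 1 t x)
        ≈⟨ *-congˡ (*-congʳ (eval-cong A (sym (+-identityʳ (ι x))))) ⟩
      cs x * (eval A (ι x + ι 0) * prodEval A 1 t x) ∎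
      where
      x+1≈1+x : ι x + ι 1 ≈ ι (suc x)
      x+1≈1+x = trans (+-congˡ (+-identityʳ 1#)) (+-comm _ _)
      regroup : ∀ c b p → c * (b * p) ≈ (c * p) * b
      regroup = solve 3 (λ c b p → c :* (b :* p) := (c :* p) :* b) refl
      regroup′ : ∀ c p b → (c * p) * b ≈ (c * b) * p
      regroup′ = solve 3 (λ c p b → (c :* p) :* b := (c :* b) :* p) refl

    weight-telescope : (∀ k → ¬ cs k ≈ 0#) → ∀ γ s {t e n} → t ℕ.+ e ≡ n → ∀ x →
      prodEval B 1 n x * (cs x ⁻¹ * Fs γ cs s (suc (t ℕ.+ x))) ≈ reducedWeight A B γ s t e x
    weight-telescope cs≉0 γ s {t} {e} {n} t+e≡n x = begin
      prodEval B 1 n x * (cs x ⁻¹ * (w * cs (t ℕ.+ x)))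
        ≡⟨ ≡.cong (λ k → prodEval B 1 k x * (cs x ⁻¹ * (w * cs (t ℕ.+ x)))) (≡.sym t+e≡n) ⟩
      prodEval B 1 (t ℕ.+ e) x * (cs x ⁻¹ * (w * cs (t ℕ.+ x)))
        ≈⟨ *-congʳ (prodEval-+ B 1 t e x) ⟩
      (prodEval B 1 t x * Bs) * (cs x ⁻¹ * (w * cs (t ℕ.+ x)))
        ≈⟨ regroup (prodEval B 1 t x) Bs (cs x ⁻¹) w (cs (t ℕ.+ x)) ⟩
      (Bs * w * cs x ⁻¹) * (cs (t ℕ.+ x) * prodEval B 1 t x)
        ≈⟨ *-congˡ (cs-telescope t x) ⟩
      (Bs * w * cs x ⁻¹) * (cs x * As)
        ≈⟨ regroup′ Bs w (cs x ⁻¹) (cs x) As ⟩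
      (Bs * w * As) * (cs x * cs x ⁻¹)
        ≈⟨ *-congˡ (⁻¹-inverse (cs x) (cs≉0 x)) ⟩
      (Bs * w * As) * 1#
        ≈⟨ *-identityʳ _ ⟩
      reducedWeight A B γ s t e x ∎
      where
      w = wgt γ s (t ℕ.+ x)
      Bs = prodEval B (t ℕ.+ 1) e x
      As = prodEval A 0 t x
      regroup : ∀ p b ci w c → (p * b) * (ci * (w * c)) ≈ (b * w * ci) * (c * p)
      regroup = solve 5 (λ p b ci w c → (p :* b) :* (ci :* (w :* c)) := (b :* w :* ci) :* (c :* p)) refl
      regroup′ : ∀ b w ci c a → (b * w * ci) * (c * a) ≈ (b * w * a) * (c * ci)
      regroup′ = solve 5 (λ b w ci c a → (b :* w :* ci) :* (c :* a) := (b :* w :* a) :* (c :* ci)) refl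

  -- Coefficients of P(z) F_s(α/z)

  ^K-+ : ∀ a m n → a ^K (m ℕ.+ n) ≈ (a ^K m) * (a ^K n)
  ^K-+ a zero n = sym (*-identityˡ _)
  ^K-+ a (suc m) n = trans (*-congˡ (^K-+ a m n)) (sym (*-assoc _ _ _))

  polyTimesFrom-Λ : ∀ (f : Laurent) α k j β H p →
                    (∀ x → f (k ℤ.+ + (j ℕ.+ x)) ≈ β * ((α ^K x) * H x)) →
                    polyTimesFrom j p f k ≈ β * Λ α H p
  polyTimesFrom-Λ f α k j β H [] h = sym (zeroʳ β)
  polyTimesFrom-Λ f α k j β H (y ∷ p) h = begin
    y * f (k ℤ.+ + j) + polyTimesFrom (suc j) p f k
      ≈⟨ +-cong (*-congˡ head) (polyTimesFrom-Λ f α k (suc j) (β * α) (H ∘ suc) p tail) ⟩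
    y * (β * H 0) + (β * α) * Λ α (H ∘ suc) p
      ≈⟨ regroup y β (H 0) α _ ⟩
    β * (y * H 0 + α * Λ α (H ∘ suc) p) ∎
    where
    f-at : ∀ {i i′} → i ≡ i′ → f (k ℤ.+ + i) ≈ f (k ℤ.+ + i′)
    f-at i≡i′ = reflexive (≡.cong (λ i → f (k ℤ.+ + i)) i≡i′)
    head : f (k ℤ.+ + j) ≈ β * H 0
    head = trans (f-at (≡.sym (ℕP.+-identityʳ j))) (trans (h 0) (*-congˡ (*-identityˡ _)))
    tail : ∀ x → f (k ℤ.+ + (suc j ℕ.+ x)) ≈ (β * α) * ((α ^K x) * H (suc x))
    tail x = trans (f-at (≡.sym (ℕP.+-suc j x))) (trans (h (suc x)) (regroup′ β α (α ^K x) (H (suc x))))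
      where
      regroup′ : ∀ b a ax h → b * ((a * ax) * h) ≈ (b * a) * (ax * h)
      regroup′ = solve 4 (λ b a ax h → b :* ((a :* ax) :* h) := (b :* a) :* (ax :* h)) refl
    regroup : ∀ y b h a l → y * (b * h) + (b * a) * l ≈ b * (y * h + a * l)
    regroup = solve 5 (λ y b h a l → y :* (b :* h) :+ (b :* a) :* l := b :* (y :* h :+ a :* l)) refl

  polyTimesFrom-drop : ∀ (f : Laurent) k j d p → (∀ e → e ℕ.< d → f (k ℤ.+ + (j ℕ.+ e)) ≈ 0#) →
                       polyTimesFrom j p f k ≈ polyTimesFrom (j ℕ.+ d) (drop d p) f k
  polyTimesFrom-drop f k j zero p h =
    reflexive (≡.cong (λ i → polyTimesFrom i p f k) (≡.sym (ℕP.+-identityʳ j)))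
  polyTimesFrom-drop f k j (suc d) [] h = refl
  polyTimesFrom-drop f k j (suc d) (y ∷ p) h = begin
    y * f (k ℤ.+ + j) + polyTimesFrom (suc j) p f k
      ≈⟨ +-congʳ (trans (*-congˡ head) (zeroʳ y)) ⟩
    0# + polyTimesFrom (suc j) p f k
      ≈⟨ +-identityˡ _ ⟩
    polyTimesFrom (suc j) p f k
      ≈⟨ polyTimesFrom-drop f k (suc j) d p tail ⟩
    polyTimesFrom (suc j ℕ.+ d) (drop d p) f k
      ≡⟨ ≡.cong (λ i → polyTimesFrom i (drop d p) f k) (≡.sym (ℕP.+-suc j d)) ⟩
    polyTimesFrom (j ℕ.+ suc d) (drop d p) f k ∎
    where
    head : f (k ℤ.+ + j) ≈ 0#
    head = trans (reflexive (≡.cong (λ i → f (k ℤ.+ + i)) (≡.sym (ℕP.+-identityʳ j)))) (h 0 (s≤s z≤n))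
    tail : ∀ e → e ℕ.< d → f (k ℤ.+ + (suc j ℕ.+ e)) ≈ 0#
    tail e e<d = trans (reflexive (≡.cong (λ i → f (k ℤ.+ + i)) (≡.sym (ℕP.+-suc j e)))) (h (suc e) (s≤s e<d))

  psiFrom-Λ : ∀ γ cs α s b p →
              psiFrom b γ cs α s p ≈ (α ^K suc b) * Λ α (λ x → Fs γ cs s (suc (b ℕ.+ x))) p
  psiFrom-Λ γ cs α s b [] = sym (zeroʳ _)
  psiFrom-Λ γ cs α s b (y ∷ p) = begin
    y * (wgt γ s b * (cs b * αᵇ)) + psiFrom (suc b) γ cs α s p
      ≈⟨ +-congˡ (psiFrom-Λ γ cs α s (suc b) p) ⟩
    y * (wgt γ s b * (cs b * αᵇ)) + (α * αᵇ) * Λ α (λ x → F (suc b ℕ.+ x)) p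
      ≈⟨ regroup y (wgt γ s b) (cs b) αᵇ α _ ⟩
    αᵇ * (y * F b + α * Λ α (λ x → F (suc b ℕ.+ x)) p)
      ≈⟨ *-congˡ (+-cong (*-congˡ (F-at (≡.sym (ℕP.+-identityʳ b))))
                          (*-congˡ (Λ-cong α p (λ x → F-at (≡.sym (ℕP.+-suc b x)))))) ⟩
    αᵇ * (y * F (b ℕ.+ 0) + α * Λ α (λ x → F (b ℕ.+ suc x)) p) ∎
    where
    αᵇ = α ^K suc b
    F = Fs γ cs s ∘ suc
    F-at : ∀ {i i′} → i ≡ i′ → F i ≈ F i′
    F-at i≡i′ = reflexive (≡.cong F i≡i′)
    regroup : ∀ y w c A a l → y * (w * (c * A)) + (a * A) * l ≈ A * (y * (w * c) + a * l)
    regroup = solve 6 (λ y w c A a l →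
      y :* (w :* (c :* A)) :+ (a :* A) :* l := A :* (y :* (w :* c) :+ a :* l)) refl

  coeff-applyUpTo : ∀ g N i → (N ℕ.≤ i → g i ≈ 0#) → coeff (applyUpTo g N) i ≈ g i
  coeff-applyUpTo g zero i h = sym (h z≤n)
  coeff-applyUpTo g (suc N) zero h = refl
  coeff-applyUpTo g (suc N) (suc i) h = coeff-applyUpTo (g ∘ suc) N i (h ∘ s≤s)

  coeff-Plis : ∀ γ cs α s P i → coeff (Plis γ cs α s P) i ≈ psi γ cs α s (drop (suc i) P)
  coeff-Plis γ cs α s P i = begin
    coeff (map ψ (map dropTo (upTo (length P)))) i
      ≡⟨ ≡.cong (λ xs → coeff (map ψ xs) i) (ListP.map-upTo dropTo (length P)) ⟩
    coeff (map ψ (applyUpTo dropTo (length P))) i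
      ≡⟨ ≡.cong (λ xs → coeff xs i) (ListP.map-applyUpTo dropTo ψ (length P)) ⟩
    coeff (applyUpTo (ψ ∘ dropTo) (length P)) i
      ≈⟨ coeff-applyUpTo (ψ ∘ dropTo) (length P) i
           (λ |P|≤i → reflexive (≡.cong ψ (ListP.drop-all (suc i) P (ℕP.m≤n⇒m≤1+n |P|≤i)))) ⟩
    ψ (dropTo i) ∎
    where
    ψ = psi γ cs α s
    dropTo = λ a → drop (suc a) P

  polyL-neg : ∀ p d → polyL p (ℤ.- (+ d)) ≡ coeff p d
  polyL-neg p zero = ≡.refl
  polyL-neg p (suc d) = ≡.refl

  substInv-Fs-nonpos : ∀ α γ cs s w → substInv α (Fs γ cs s) (ℤ.- (+ w)) ≈ 0#
  substInv-Fs-nonpos α γ cs s zero = zeroʳ 1#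
  substInv-Fs-nonpos α γ cs s (suc w) = refl

  polyTimes-Fs-nonpos : ∀ α γ cs s P d →
    polyTimes P (substInv α (Fs γ cs s)) (ℤ.- (+ d)) ≈ α * Λ α (Fs γ cs s ∘ suc) (drop (suc d) P)
  polyTimes-Fs-nonpos α γ cs s P d =
    trans (polyTimesFrom-drop f k 0 (suc d) P below)
          (polyTimesFrom-Λ f α k (suc d) α _ (drop (suc d) P) above)
    where
    f = substInv α (Fs γ cs s)
    k = ℤ.- (+ d)
    below : ∀ e → e ℕ.< suc d → f (k ℤ.+ + e) ≈ 0#
    below e e<1+d = trans (reflexive (≡.cong f (-d+e≡-[d∸e] (ℕP.≤-pred e<1+d))))
                          (substInv-Fs-nonpos α γ cs s (d ℕ.∸ e))
    above : ∀ x → f (k ℤ.+ + (suc d ℕ.+ x)) ≈ α * ((α ^K x) * Fs γ cs s (suc x))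
    above x = trans (reflexive (≡.cong f (-d+[1+d+x]≡1+x d x))) (*-assoc _ _ _)

  polyTimes-Fs-nonpos≈Plis : ∀ α γ cs s P d →
    polyTimes P (substInv α (Fs γ cs s)) (ℤ.- (+ d)) ≈ polyL (Plis γ cs α s P) (ℤ.- (+ d))
  polyTimes-Fs-nonpos≈Plis α γ cs s P d = begin
    polyTimes P (substInv α (Fs γ cs s)) (ℤ.- (+ d))
      ≈⟨ polyTimes-Fs-nonpos α γ cs s P d ⟩
    α * Λ α (Fs γ cs s ∘ suc) (drop (suc d) P)
      ≈⟨ *-congʳ (*-identityʳ α) ⟨
    (α ^K 1) * Λ α (Fs γ cs s ∘ suc) (drop (suc d) P)
      ≈⟨ psiFrom-Λ γ cs α s 0 (drop (suc d) P) ⟨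
    psi γ cs α s (drop (suc d) P)
      ≈⟨ coeff-Plis γ cs α s P d ⟨
    coeff (Plis γ cs α s P) d
      ≡⟨ polyL-neg (Plis γ cs α s P) d ⟨
    polyL (Plis γ cs α s P) (ℤ.- (+ d)) ∎

  polyTimes-Fs-pos : ∀ α γ cs s P t →
    polyTimes P (substInv α (Fs γ cs s)) (+ suc t)
      ≈ (α ^K suc t) * Λ α (λ x → Fs γ cs s (suc (t ℕ.+ x))) P
  polyTimes-Fs-pos α γ cs s P t =
    polyTimesFrom-Λ (substInv α (Fs γ cs s)) α (+ suc t) 0 (α ^K suc t) _ P
      (λ x → trans (*-congʳ (^K-+ α (suc t) x)) (*-assoc _ _ _))

  -- Lengths of coefficient lists

  length-+P : ∀ p q {n} → length p ℕ.≤ n → length q ℕ.≤ n → length (p +P q) ℕ.≤ n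
  length-+P [] q hp hq = hq
  length-+P (a ∷ p) [] hp hq = hp
  length-+P (a ∷ p) (b ∷ q) {suc n} (s≤s hp) (s≤s hq) = s≤s (length-+P p q hp hq)

  length-scale : ∀ a q → length (scale a q) ≡ length q
  length-scale a q = ListP.length-map (a *_) q

  length-*P : ∀ p q d e → length p ℕ.≤ suc d → length q ℕ.≤ suc e →
              length (p *P q) ℕ.≤ suc (d ℕ.+ e)
  length-*P [] q d e hp hq = z≤n
  length-*P (a ∷ []) q zero e hp hq =
    length-+P (scale a q) (0# ∷ []) (ℕP.≤-trans (ℕP.≤-reflexive (length-scale a q)) hq) (s≤s z≤n)
  length-*P (a ∷ b ∷ p) q zero e (s≤s ()) hq
  length-*P (a ∷ p) q (suc d) e (s≤s hp) hq =
    length-+P (scale a q) (0# ∷ (p *P q))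
      (ℕP.≤-trans (ℕP.≤-reflexive (length-scale a q)) (ℕP.≤-trans hq (s≤s (ℕP.m≤n+m e (suc d)))))
      (s≤s (length-*P p q d e hp hq))

  length-diagFrom : ∀ k w p → length (diagFrom k w p) ≡ length p
  length-diagFrom k w [] = ≡.refl
  length-diagFrom k w (a ∷ p) = ≡.cong suc (length-diagFrom (suc k) w p)

  length-chainFrom : ∀ B j k p → length (chainFrom B j k p) ≡ length p
  length-chainFrom B j zero p = ≡.refl
  length-chainFrom B j (suc k) p =
    ≡.trans (length-diagFrom 0 _ (chainFrom B (suc j) k p)) (length-chainFrom B (suc j) k p)

  length-linP-^P : ∀ a N → length (linP a ^P N) ℕ.≤ suc N
  length-linP-^P a zero = s≤s z≤n
  length-linP-^P a (suc N) = length-*P (linP a) (linP a ^P N) 1 N (s≤s (s≤s z≤n)) (length-linP-^P a N)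

  length-prodFin : ∀ m (f : Fin m → Poly) D → (∀ i → length (f i) ℕ.≤ suc D) →
                   length (prodFin m f) ℕ.≤ suc (m ℕ.* D)
  length-prodFin zero f D h = s≤s z≤n
  length-prodFin (suc m) f D h =
    length-*P (f Fin.zero) _ D (m ℕ.* D) (h Fin.zero) (length-prodFin m (f ∘ Fin.suc) D (h ∘ Fin.suc))

  length-monoP : ∀ l → length (monoP l) ℕ.≤ suc l
  length-monoP zero = s≤s z≤n
  length-monoP (suc l) = s≤s (length-monoP l)

  coeff-beyond-length : ∀ p k → length p ℕ.≤ k → coeff p k ≡ 0#
  coeff-beyond-length [] k h = ≡.refl
  coeff-beyond-length (a ∷ p) (suc k) (s≤s h) = coeff-beyond-length p k h

  length≤⇒DegLe : ∀ p d → length p ℕ.≤ suc d → DegLe p d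
  length≤⇒DegLe p d h k d<k = reflexive (coeff-beyond-length p k (ℕP.≤-trans h d<k))

  -- The polynomial P_ℓ

  Q : (m : ℕ) → (Fin m → Carrier) → (N l : ℕ) → Poly
  Q m α N l = monoP l *P prodFin m (λ i → linP (α i) ^P N)

  vanishes-Q : ∀ m α N l i → VanishesToOrder (α i) N (Q m α N l)
  vanishes-Q m α N l i =
    vanishes-*P-left (α i) N (monoP l) _ (vanishes-prodFin (α i) N m _ i (vanishes-^P (α i) N))

  length-Q : ∀ m α N l → length (Q m α N l) ℕ.≤ suc (l ℕ.+ m ℕ.* N)
  length-Q m α N l =
    length-*P (monoP l) _ l (m ℕ.* N) (length-monoP l)
      (length-prodFin m _ N (λ i → length-linP-^P (α i) N))

  length-Pl : ∀ A B r cs m α n l → length (Pl A B r cs m α n l) ≡ length (Q m α (r ℕ.* n) l)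
  length-Pl A B r cs m α n l =
    ≡.trans (ListP.length-map _ (Tc cs chain))
      (≡.trans (length-diagFrom 0 _ chain) (length-chainFrom B 1 (n ℕ.∸ 1) q))
    where
    q = Q m α (r ℕ.* n) l
    chain = chainFrom B 1 (n ℕ.∸ 1) q

  Pl-degree : ∀ A B r cs m α n l → DegLe (Pl A B r cs m α n l) (r ℕ.* m ℕ.* n ℕ.+ l)
  Pl-degree A B r cs m α n l =
    length≤⇒DegLe (Pl A B r cs m α n l) (r ℕ.* m ℕ.* n ℕ.+ l)
      (ℕP.≤-trans (ℕP.≤-reflexive (length-Pl A B r cs m α n l))
        (≡.subst (λ d → length (Q m α (r ℕ.* n) l) ℕ.≤ suc d) (l+m[rn]≡rmn+l r m n l)
          (length-Q m α (r ℕ.* n) l)))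

  Λ-Pl : ∀ β A B r cs m α n′ l R →
         Λ β R (Pl A B r cs m α (suc n′) l)
           ≈ ι ((n′ !) ℕ.^ r) ⁻¹ * Λ β (λ x → prodEval B 1 n′ x * (cs x ⁻¹ * R x))
                                       (Q m α (r ℕ.* suc n′) l)
  Λ-Pl β A B r cs m α n′ l R =
    trans (Λ-scale β R _ (Tc cs chain))
      (*-congˡ (trans (Λ-diagFrom β 0 (λ k → cs k ⁻¹) R chain) (Λ-chainFrom β B _ 1 n′ q)))
    where
    q = Q m α (r ℕ.* suc n′) l
    chain = chainFrom B 1 n′ q

  module Padé (A B : Poly) (r : ℕ) (A-deg : DegLe A r) (B-deg : DegLe B r)
              (cs : ℕ → Carrier) (B≉0 : ∀ j → ¬ eval B (ι j) ≈ 0#) (cs≉0 : ∀ k → ¬ cs k ≈ 0#)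
              (cs-rec : ∀ k → cs (suc k) ≈ cs k * (eval A (ι k) * (eval B (ι (suc k)) ⁻¹)))
              (γ : ℕ → Carrier) (m : ℕ) (α : Fin m → Carrier) (n′ l : ℕ)
              where

    P : Poly
    P = Pl A B r cs m α (suc n′) l

    Λ-P-vanishes : ∀ i s → s ℕ.< r → ∀ t → t ℕ.≤ n′ →
                   Λ (α i) (λ x → Fs γ cs s (suc (t ℕ.+ x))) P ≈ 0#
    Λ-P-vanishes i s s<r t t≤n′ = begin
      Λ (α i) (λ x → Fs γ cs s (suc (t ℕ.+ x))) P
        ≈⟨ Λ-Pl (α i) A B r cs m α n′ l _ ⟩
      κ * Λ (α i) (λ x → prodEval B 1 n′ x * (cs x ⁻¹ * Fs γ cs s (suc (t ℕ.+ x)))) q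
        ≈⟨ *-congˡ (Λ-cong (α i) q (weight-telescope A B cs B≉0 cs-rec cs≉0 γ s t+e≡n′)) ⟩
      κ * Λ (α i) (reducedWeight A B γ s t e) q
        ≈⟨ *-congˡ (vanishes-Q m α (r ℕ.* suc n′) l i _
             (DegLt-mono _ _ _ (suc[er+s+tr]≤r[1+n] {r} {s} {t} {e} s<r t+e≡n′)
               (DegLt-reducedWeight A B r A-deg B-deg γ s t e))) ⟩
      κ * 0#
        ≈⟨ zeroʳ κ ⟩
      0# ∎
      where
      κ = ι ((n′ !) ℕ.^ r) ⁻¹
      q = Q m α (r ℕ.* suc n′) l
      e = n′ ℕ.∸ t
      t+e≡n′ : t ℕ.+ e ≡ n′
      t+e≡n′ = ℕP.m+[n∸m]≡n t≤n′

    Padé-order : ∀ i s → s ℕ.< r →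
      OrdGe (polyTimes P (substInv (α i) (Fs γ cs s)) -L polyL (Plis γ cs (α i) s P)) (+ (suc n′ ℕ.+ 1))
    Padé-order i s s<r (+ zero) _ =
      x≈y⇒x∙y⁻¹≈ε (polyTimes-Fs-nonpos≈Plis (α i) γ cs s P 0)
    Padé-order i s s<r -[1+ d ] _ =
      x≈y⇒x∙y⁻¹≈ε (polyTimes-Fs-nonpos≈Plis (α i) γ cs s P (suc d))
    Padé-order i s s<r (+ suc t) 1+t<n+1 = x≈y⇒x∙y⁻¹≈ε (begin
      polyTimes P (substInv (α i) (Fs γ cs s)) (+ suc t)
        ≈⟨ polyTimes-Fs-pos (α i) γ cs s P t ⟩
      (α i ^K suc t) * Λ (α i) (λ x → Fs γ cs s (suc (t ℕ.+ x))) P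
        ≈⟨ *-congˡ (Λ-P-vanishes i s s<r t t≤n′) ⟩
      (α i ^K suc t) * 0#
        ≈⟨ zeroʳ _ ⟩
      0# ∎)
      where
      t≤n′ : t ℕ.≤ n′
      t≤n′ = ℕP.≤-pred (≡.subst (suc t ℕ.≤_) (ℕP.+-comm n′ 1) (ℕP.≤-pred (ℤP.drop‿+<+ 1+t<n+1)))

proposition3p6 : ∀ {c ℓ : Level} (K : Field c ℓ) → let open Ops K in
    CharZero →
    (A B : Poly) (r : ℕ) →
    0 ℕ.< r → DegLe A r → DegLe B r → (¬ coeff A r ≈ 0# ⊎ ¬ coeff B r ≈ 0#) →
    (∀ (j : ℕ) → ¬ (eval A (ι j) * eval B (ι j)) ≈ 0#) →
    (cs : ℕ → Carrier) →
    (∀ k → ¬ cs k ≈ 0#) →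
    (∀ k → cs (suc k) ≈ cs k * (eval A (ι k) * (eval B (ι (suc k)) ⁻¹))) →
    (γ : ℕ → Carrier) →
    (m : ℕ) → 1 ℕ.≤ m →
    (α : Fin m → Carrier) →
    (∀ i → ¬ α i ≈ 0#) →
    (∀ i j → α i ≈ α j → i ≡ j) →
    (n l : ℕ) → 1 ℕ.≤ n →
    DegLe (Pl A B r cs m α n l) (r ℕ.* m ℕ.* n ℕ.+ l) ×
    (∀ (i : Fin m) (s : ℕ) → s ℕ.< r →
      OrdGe (polyTimes (Pl A B r cs m α n l) (substInv (α i) (Fs γ cs s))
             -L polyL (Plis γ cs (α i) s (Pl A B r cs m α n l)))
            (+ (n ℕ.+ 1)))
-- Char 0, r > 0, the leading coefficients and the conditions on m and the α_i are not
-- needed for the Padé conditions themselves.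
proposition3p6 K _ A B r _ A-deg B-deg _ AB≉0 cs cs≉0 cs-rec γ m _ α _ _ (suc n′) l _ =
  Pl-degree K A B r cs m α (suc n′) l , Padé-order
  where
  open Ops K using (_≈_; 0#; eval; ι)
  B≉0 : ∀ j → ¬ eval B (ι j) ≈ 0#
  B≉0 j = x*y≉0⇒y≉0 K (AB≉0 j)
  open Padé K A B r A-deg B-deg cs B≉0 cs≉0 cs-rec γ m α n′ l
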